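{- Let $\Sigma$ be a finite alphabet, $k\in\mathbb{N}$, and $w,\tilde w\in\Sigma^*$ with $m\coloneqq\iota(w)=\iota(\tilde w)<k$, with $\alpha$-$\beta$-factorizations $w=\alpha_0\beta_1\alpha_1\cdots\beta_m\alpha_m$ and $\tilde w=\tilde\alpha_0\tilde\beta_1\tilde\alpha_1\cdots\tilde\beta_m\tilde\alpha_m$. Then $w\sim_k\tilde w$ if and only if $\alpha_i\sim_{k-m}\tilde\alpha_i$ for all $i\in\{0,\dots,m\}$ and, for $w'\coloneqq\alpha_0\tilde\beta_1\alpha_1\cdots\tilde\beta_m\alpha_m$, we have $w\sim_k w'$.
   Context: A word $u$ is a scattered factor of $w$ if $u$ is obtained from $w$ by deleting some letters (keeping order). For $k\in\mathbb{N}_0$, $u\sim_k v$ iff $u$ and $v$ have exactly the same scattered factors of length at most $k$. $\iota(w)$ is the largest $\ell$ such that every word of $\Sigma^\ell$ is a scattered factor of $w$. The arch factorization of $w$ is the unique factorization $w=\mathrm{ar}_1(w)\cdots\mathrm{ar}_\ell(w)\mathrm{re}(w)$ where each arch contains every letter of $\Sigma$ and its last letter occurs exactly once in it, and $\mathrm{re}(w)$ does not contain every letter of $\Sigma$; $\ell=\iota(w)$. With $w^R$ the reversal, $\mathrm{ra}_i(w)\coloneqq(\mathrm{ar}_{\iota(w)-i+1}(w^R))^R$ and $\mathrm{er}(w)\coloneqq(\mathrm{re}(w^R))^R$. The $\alpha$-$\beta$-factorization is $w=\alpha_0\beta_1\alpha_1\cdots\beta_{\iota(w)}\alpha_{\iota(w)}$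 with $\mathrm{ar}_i(w)=\alpha_{i-1}\beta_i$, $\mathrm{ra}_i(w)=\beta_i\alpha_i$ for $i\in\{1,\dots,\iota(w)\}$, $\alpha_0=\mathrm{er}(w)$, $\alpha_{\iota(w)}=\mathrm{re}(w)$. -}

module Defs where

open import Data.Nat using (ℕ; zero; suc; _≤_; _≡ᵇ_)
open import Data.Fin using (Fin; zero; suc; inject₁; fromℕ; opposite)
open import Data.List using (List; []; _∷_; _++_; _∷ʳ_; length; reverse; concat; tabulate)
open import Data.List.Membership.Propositional using (_∈_)
open import Data.List.Relation.Binary.Sublist.Propositional using (_⊆_)
open import Data.Product using (_×_; ∃; ∃-syntax; _,_)
open import Relation.Nullary using (¬_)
open import Relation.Binary.PropositionalEquality using (_≡_)
open import Function.Bundles using (_⇔_)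

Word : ℕ → Set
Word σ = List (Fin σ)

ScatteredFactor : ∀ {σ} → Word σ → Word σ → Set
ScatteredFactor u w = u ⊆ w

_∼[_]_ : ∀ {σ} → Word σ → ℕ → Word σ → Set
u ∼[ k ] v = ∀ (x : Word _) → length x ≤ k → (ScatteredFactor x u ⇔ ScatteredFactor x v)

Universal : ∀ {σ} → ℕ → Word σ → Set
Universal {σ} ℓ w = ∀ (u : Word σ) → length u ≡ ℓ → ScatteredFactor u w

-- ι(w) = m : m is the largest ℓ with w ℓ-universal
-- (ℓ-universality is downward closed, so this says m is the maximum)
ι≡ : ∀ {σ} → Word σ → ℕ → Set
ι≡ w m = Universal m w × ¬ Universal (suc m) w

Complete : ∀ {σ} → Word σ → Set
Complete {σ} a = ∀ (x : Fin σ) → x ∈ a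

IsArch : ∀ {σ} → Word σ → Set
IsArch {σ} a = Complete a × ∃[ b ] ∃[ x ] (a ≡ b ∷ʳ x × ¬ (x ∈ b))

data AllArches {σ} : List (Word σ) → Set where
  [] : AllArches []
  _∷_ : ∀ {a as} → IsArch a → AllArches as → AllArches (a ∷ as)

IsArchFact : ∀ {σ} → Word σ → List (Word σ) → Word σ → Set
IsArchFact w arches re = (w ≡ concat arches ++ re) × AllArches arches × ¬ Complete re

-- α₀ β₁ α₁ ⋯ βₘ αₘ
abWord : ∀ {σ} (m : ℕ) → (Fin (suc m) → Word σ) → (Fin m → Word σ) → Word σ
abWord zero α β = α zero
abWord (suc m) α β = abWord m (λ i → α (inject₁ i)) (λ i → β (inject₁ i)) ++ (β (fromℕ m) ++ α (fromℕ (suc m)))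

-- α-β-factorization of w with m arches:
--  arᵢ(w) = αᵢ₋₁ βᵢ (i = 1..m), re(w) = αₘ;
--  raᵢ(w) = βᵢ αᵢ, i.e. ar_{m-i+1}(wᴿ) = (βᵢ αᵢ)ᴿ, and er(w) = α₀, i.e. re(wᴿ) = α₀ᴿ.
-- (Fin indices: α j ↦ α_j, β i ↦ β_{i+1}.)
IsABFact : ∀ {σ} → Word σ → (m : ℕ) → (Fin (suc m) → Word σ) → (Fin m → Word σ) → Set
IsABFact {σ} w m α β =
  IsArchFact w (tabulate (λ (i : Fin m) → α (inject₁ i) ++ β i)) (α (fromℕ m))
  × IsArchFact (reverse w)
      (tabulate (λ (j : Fin m) → reverse (β (opposite j) ++ α (suc (opposite j)))))
      (reverse (α zero))

-- Write w = P ++ αᵢ ++ S with P = ar₁ ⋯ arᵢ and S = raᵢ₊₁ ⋯ raₘ. Then P is i-universal and S is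
-- (m − i)-universal, so in any embedding of a word of length at most k into w all but at most
-- k − m of its letters can be moved into P or S; hence αᵢ may be exchanged for any
-- (k − m)-equivalent word without changing the k-spectrum, and replacing the α̃ᵢ by the αᵢ one
-- at a time shows w̃ ∼ₖ w′. Conversely, the word of last letters of the arches of P can only be
-- embedded into P ++ R by using all of P (and symmetrically for S read backwards), so
-- surrounding a short scattered factor of αᵢ by these two words transfers it from w to w̃.

module Submission where

open import Defs
open import Data.Nat using (ℕ; zero; suc; _+_; _∸_; _⊓_; _≤_; _<_; z≤n; s≤s)
open import Data.Nat.Properties
open import Data.Nat.Tactic.RingSolver using (solve-∀)
open import Data.Fin using (Fin; zero; suc; inject₁; fromℕ; opposite)
open import Data.Fin.Properties using (opposite-involutive)
open import Data.Fin.Relation.Unary.Top using (view; ‵fromℕ; ‵inject₁)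
open import Data.List using (List; []; _∷_; _++_; [_]; length; reverse; concat; tabulate; take; drop; replicate)
open import Data.List.Properties
  using (++-assoc; ++-identityʳ; length-++; length-take; length-drop; length-replicate; length-reverse;
         take++drop≡id; reverse-++; reverse-involutive; concat-++)
open import Data.List.Membership.Propositional using (_∈_)
open import Data.List.Membership.Propositional.Properties using (∈-++⁺ˡ; ∈-++⁺ʳ; ∈-++⁻)
open import Data.List.Relation.Unary.Any using (here; there)
import Data.List.Relation.Unary.Any.Properties as Any
open import Data.List.Relation.Binary.Sublist.Propositional
  using (_⊆_; []; _∷_; _∷ʳ_; ⊆-refl; ⊆-trans; from∈; to∈)
open import Data.List.Relation.Binary.Sublist.Propositional.Properties
  using (++⁺; ++⁺ˡ; ++⁺ʳ; ∷⁻; reverse⁺; reverse⁻; []⊆-universal)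
open import Data.Product using (∃-syntax; ∃₂; _×_; _,_; proj₁; proj₂)
open import Data.Sum using (inj₁; inj₂)
open import Function.Base using (_∘_)
open import Function.Bundles using (_⇔_; mk⇔; Equivalence)
import Function.Properties.Equivalence as ⇔
open import Relation.Nullary using (¬_; contradiction)
open import Relation.Binary.PropositionalEquality hiding ([_])
open import Relation.Binary.Bundles using (Setoid)
import Relation.Binary.Reasoning.Setoid as SetoidReasoning
open import Level using (0ℓ)

private variable
  A : Set
  σ : ℕ

⊆-split-++ : ∀ (xs ys : List A) {zs} → zs ⊆ xs ++ ys →
             ∃₂ λ us vs → zs ≡ us ++ vs × us ⊆ xs × vs ⊆ ys
⊆-split-++ []       ys τ = [] , _ , refl , [] , τ
⊆-split-++ (x ∷ xs) ys (.x ∷ʳ τ) with us , vs , refl , τ₁ , τ₂ ← ⊆-split-++ xs ys τ =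
  us , vs , refl , x ∷ʳ τ₁ , τ₂
⊆-split-++ (x ∷ xs) ys (refl ∷ τ) with us , vs , refl , τ₁ , τ₂ ← ⊆-split-++ xs ys τ =
  x ∷ us , vs , refl , refl ∷ τ₁ , τ₂

∷-⊆-++-∉ : ∀ {x : A} {xs} ys {zs} → ¬ x ∈ ys → x ∷ xs ⊆ ys ++ zs → x ∷ xs ⊆ zs
∷-⊆-++-∉ []       x∉ τ          = τ
∷-⊆-++-∉ (y ∷ ys) x∉ (.y ∷ʳ τ) = ∷-⊆-++-∉ ys (x∉ ∘ there) τ
∷-⊆-++-∉ (y ∷ ys) x∉ (refl ∷ τ) = contradiction (here refl) x∉

m∸[m∸n]≤n : ∀ m n → m ∸ (m ∸ n) ≤ n
m∸[m∸n]≤n m n = m≤n+o⇒m∸n≤o m (m ∸ n) (subst (m ≤_) (+-comm n (m ∸ n)) (m≤n+m∸n m n))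

trisect : ∀ s t (v : List A) → ∃[ c₁ ] ∃[ q ] ∃[ c₃ ]
          v ≡ c₁ ++ q ++ c₃ × length c₁ ≤ s × length q ≤ length v ∸ (s + t) × length c₃ ≤ t
trisect s t v = take s v , take d r , drop d r , v≡ , |c₁|≤ , |q|≤ , |c₃|≤
  where
  r = drop s v
  d = length r ∸ t
  v≡ : v ≡ take s v ++ take d r ++ drop d r
  v≡ = trans (sym (take++drop≡id s v)) (cong (take s v ++_) (sym (take++drop≡id d r)))
  |c₁|≤ : length (take s v) ≤ s
  |c₁|≤ = subst (_≤ s) (sym (length-take s v)) (m⊓n≤m s (length v))
  |q|≤ : length (take d r) ≤ length v ∸ (s + t)
  |q|≤ = begin
    length (take d r)  ≡⟨ length-take d r ⟩
    d ⊓ length r       ≤⟨ m⊓n≤m d (length r) ⟩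
    length r ∸ t       ≡⟨ cong (_∸ t) (length-drop s v) ⟩
    length v ∸ s ∸ t   ≡⟨ ∸-+-assoc (length v) s t ⟩
    length v ∸ (s + t) ∎
    where open ≤-Reasoning
  |c₃|≤ : length (drop d r) ≤ t
  |c₃|≤ = subst (_≤ t) (sym (length-drop d r)) (m∸[m∸n]≤n (length r) t)

_≲[_]_ : Word σ → ℕ → Word σ → Set
u ≲[ k ] v = ∀ x → length x ≤ k → x ⊆ u → x ⊆ v

module _ {k : ℕ} {u v : Word σ} where

  ∼-sym : u ∼[ k ] v → v ∼[ k ] u
  ∼-sym u∼v x |x|≤ = ⇔.sym (u∼v x |x|≤)

  ∼-trans : ∀ {w} → u ∼[ k ] v → v ∼[ k ] w → u ∼[ k ] w
  ∼-trans u∼v v∼w x |x|≤ = ⇔.trans (u∼v x |x|≤) (v∼w x |x|≤)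

  ∼⇒≲ : u ∼[ k ] v → u ≲[ k ] v
  ∼⇒≲ u∼v x |x|≤ = Equivalence.to (u∼v x |x|≤)

  ≲∧≳⇒∼ : u ≲[ k ] v → v ≲[ k ] u → u ∼[ k ] v
  ≲∧≳⇒∼ u≲v v≲u x |x|≤ = mk⇔ (u≲v x |x|≤) (v≲u x |x|≤)

∼-setoid : ℕ → ℕ → Setoid 0ℓ 0ℓ
∼-setoid σ k = record
  { Carrier       = Word σ
  ; _≈_           = _∼[ k ]_
  ; isEquivalence = record { refl = λ x _ → ⇔.refl ; sym = ∼-sym ; trans = ∼-trans }
  }

module ∼-Reasoning {σ} (k : ℕ) = SetoidReasoning (∼-setoid σ k)

∼-resp-≡ : ∀ {j k} {u v : Word σ} → j ≡ k → u ∼[ j ] v → u ∼[ k ] v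
∼-resp-≡ refl u∼v = u∼v

∈-resp-∼ : ∀ {n x} {u v : Word σ} → 1 ≤ n → u ∼[ n ] v → x ∈ v → x ∈ u
∈-resp-∼ {x = x} 1≤n u∼v x∈v = to∈ (Equivalence.from (u∼v [ x ] 1≤n) (from∈ x∈v))

universal-≤ : ∀ {ℓ} {w : Word σ} → Universal ℓ w → ∀ u → length u ≤ ℓ → u ⊆ w
universal-≤ U []      _  = []⊆-universal _
universal-≤ {ℓ = ℓ} U (c ∷ u) |u|≤ℓ = ⊆-trans (++⁺ʳ padding ⊆-refl) (U (c ∷ u ++ padding) |padded|≡ℓ)
  where
  padding = replicate (ℓ ∸ length (c ∷ u)) c
  |padded|≡ℓ : length (c ∷ u ++ padding) ≡ ℓ
  |padded|≡ℓ = trans (length-++ (c ∷ u))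
                (trans (cong (length (c ∷ u) +_) (length-replicate _)) (m+[n∸m]≡n |u|≤ℓ))

universal-0 : (w : Word σ) → Universal 0 w
universal-0 w [] _ = []⊆-universal w

complete⇒universal-1 : {w : Word σ} → Complete w → Universal 1 w
complete⇒universal-1 C (x ∷ []) _ = from∈ (C x)

universal-++ : ∀ {a b} {X Y : Word σ} → Universal a X → Universal b Y → Universal (a + b) (X ++ Y)
universal-++ {a = a} {b} UX UY u |u|≡a+b =
  subst (_⊆ _) (take++drop≡id a u) (++⁺ (UX (take a u) |take|≡a) (UY (drop a u) |drop|≡b))
  where
  |take|≡a : length (take a u) ≡ a
  |take|≡a = trans (length-take a u) (trans (cong (a ⊓_) |u|≡a+b) (m≤n⇒m⊓n≡m (m≤m+n a b)))
  |drop|≡b : length (drop a u) ≡ b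
  |drop|≡b = trans (length-drop a u) (trans (cong (_∸ a) |u|≡a+b) (m+n∸m≡n a b))

+-fits : ∀ {l c x} → 1 ≤ c → c ≤ x ∸ l → l + c ≤ x
+-fits {l} {c} {x} 1≤c c≤ = begin
  l + c       ≤⟨ +-monoʳ-≤ l c≤ ⟩
  l + (x ∸ l) ≡⟨ m+[n∸m]≡n {l} (<⇒≤ (m∸n≢0⇒n<m x∸l≢0)) ⟩
  x           ∎
  where
  open ≤-Reasoning
  x∸l≢0 : x ∸ l ≢ 0
  x∸l≢0 x∸l≡0 = <⇒≱ 1≤c (subst (c ≤_) x∸l≡0 c≤)

⊆-universal-++ʳ : ∀ {x} {X u c : Word σ} → u ⊆ X → Universal x X → length c ≤ x ∸ length u → u ++ c ⊆ X
⊆-universal-++ʳ {u = u} {[]} u⊆X _ _ = subst (_⊆ _) (sym (++-identityʳ u)) u⊆X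
⊆-universal-++ʳ {u = u} {c ∷ cs} _ U c≤ =
  universal-≤ U (u ++ c ∷ cs) (subst (_≤ _) (sym (length-++ u)) (+-fits (s≤s z≤n) c≤))

⊆-universal-++ˡ : ∀ {y} {Y u c : Word σ} → u ⊆ Y → Universal y Y → length c ≤ y ∸ length u → c ++ u ⊆ Y
⊆-universal-++ˡ {c = []} u⊆Y _ _ = u⊆Y
⊆-universal-++ˡ {y = y} {u = u} {c ∷ cs} _ U c≤ =
  universal-≤ U (c ∷ cs ++ u)
    (subst (_≤ y) (sym (trans (length-++ (c ∷ cs)) (+-comm (length (c ∷ cs)) (length u))))
      (+-fits (s≤s z≤n) c≤))

-- For a concatenation of n arches, p can be taken to be the word of their last letters.
Exhaustible : ℕ → Word σ → Set
Exhaustible {σ} n P = ∃[ p ] length p ≡ n × (∀ (v R : Word σ) → p ++ v ⊆ P ++ R → v ⊆ R)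

exhaustible-[] : Exhaustible {σ} 0 []
exhaustible-[] = [] , refl , λ v R τ → τ

exhaustible-++ : ∀ {a b} {X Y : Word σ} → Exhaustible a X → Exhaustible b Y → Exhaustible (a + b) (X ++ Y)
exhaustible-++ {X = X} {Y} (p , |p|≡a , p-exh) (q , |q|≡b , q-exh) =
  p ++ q , trans (length-++ p) (cong₂ _+_ |p|≡a |q|≡b) ,
  λ v R τ → q-exh v R (p-exh (q ++ v) (Y ++ R) (subst₂ _⊆_ (++-assoc p q v) (++-assoc X Y R) τ))

arch⇒exhaustible : {a : Word σ} → IsArch a → Exhaustible 1 a
arch⇒exhaustible (_ , b , x , refl , x∉b) =
  [ x ] , refl , λ v R τ → ∷⁻ (∷-⊆-++-∉ b x∉b (subst (x ∷ v ⊆_) (++-assoc b [ x ] R) τ))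

-- What the argument uses about the factors before and after αᵢ: they are concatenations of
-- arches, resp. of reversed arches.
LeftContext : ℕ → Word σ → Set
LeftContext n P = Universal n P × Exhaustible n P

RightContext : ℕ → Word σ → Set
RightContext n S = Universal n S × Exhaustible n (reverse S)

leftContext-[] : LeftContext {σ} 0 []
leftContext-[] = universal-0 [] , exhaustible-[]

rightContext-[] : RightContext {σ} 0 []
rightContext-[] = universal-0 [] , exhaustible-[]

leftContext-++ : ∀ {a b} {X Y : Word σ} → LeftContext a X → LeftContext b Y → LeftContext (a + b) (X ++ Y)
leftContext-++ (UX , EX) (UY , EY) = universal-++ UX UY , exhaustible-++ EX EY

rightContext-++ : ∀ {a b} {X Y : Word σ} → RightContext a X → RightContext b Y → RightContext (a + b) (X ++ Y)
rightContext-++ {a = a} {b} {X} {Y} (UX , EX) (UY , EY) =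
  universal-++ UX UY , subst₂ Exhaustible (+-comm b a) (sym (reverse-++ X Y)) (exhaustible-++ EY EX)

arch⇒leftContext : {a : Word σ} → IsArch a → LeftContext 1 a
arch⇒leftContext arch = complete⇒universal-1 (proj₁ arch) , arch⇒exhaustible arch

reverseArch⇒complete : {a : Word σ} → IsArch (reverse a) → Complete a
reverseArch⇒complete arch = Any.reverse⁻ ∘ proj₁ arch

reverseArch⇒rightContext : {a : Word σ} → IsArch (reverse a) → RightContext 1 a
reverseArch⇒rightContext arch = complete⇒universal-1 (reverseArch⇒complete arch) , arch⇒exhaustible arch

middle-length-≤ : ∀ l₁ l₂ l₃ x y n → l₁ + (l₂ + l₃) ≤ x + y + n → l₂ ∸ ((x ∸ l₁) + (y ∸ l₃)) ≤ n
middle-length-≤ l₁ l₂ l₃ x y n ≤x+y+n =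
  m≤n+o⇒m∸n≤o l₂ ((x ∸ l₁) + (y ∸ l₃)) (+-cancelˡ-≤ (l₁ + l₃) _ _ (begin
    l₁ + l₃ + l₂                          ≡⟨ shuffle l₁ l₂ l₃ ⟩
    l₁ + (l₂ + l₃)                        ≤⟨ ≤x+y+n ⟩
    x + y + n                             ≤⟨ +-monoˡ-≤ n (+-mono-≤ (m≤n+m∸n x l₁) (m≤n+m∸n y l₃)) ⟩
    l₁ + (x ∸ l₁) + (l₃ + (y ∸ l₃)) + n   ≡⟨ regroup l₁ (x ∸ l₁) l₃ (y ∸ l₃) n ⟩
    l₁ + l₃ + ((x ∸ l₁) + (y ∸ l₃) + n)   ∎))
  where
  open ≤-Reasoning
  shuffle : ∀ a b c → a + c + b ≡ a + (b + c)
  shuffle = solve-∀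
  regroup : ∀ a b c d e → a + b + (c + d) + e ≡ a + c + (b + d + e)
  regroup = solve-∀

≲-middle⁺ : ∀ {x y n} {X a b Y : Word σ} → Universal x X → Universal y Y → a ≲[ n ] b →
            (X ++ a ++ Y) ≲[ x + y + n ] (X ++ b ++ Y)
≲-middle⁺ {x = x} {y} {n} {X} {a} {b} {Y} UX UY a≲b u |u|≤ τ
  with u₁ , r , refl , τ₁ , τᵣ ← ⊆-split-++ X (a ++ Y) τ
  with u₂ , u₃ , refl , τ₂ , τ₃ ← ⊆-split-++ a Y τᵣ
  with c₁ , q , c₃ , refl , |c₁|≤ , |q|≤ , |c₃|≤ ← trisect (x ∸ length u₁) (y ∸ length u₃) u₂ =
  subst (_⊆ X ++ b ++ Y) (sym regroup)
    (++⁺ (⊆-universal-++ʳ τ₁ UX |c₁|≤) (++⁺ (a≲b q |q|≤n q⊆a) (⊆-universal-++ˡ τ₃ UY |c₃|≤)))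
  where
  q⊆a : q ⊆ a
  q⊆a = ⊆-trans (++⁺ˡ c₁ (++⁺ʳ c₃ ⊆-refl)) τ₂
  |u|≡ : length (u₁ ++ (c₁ ++ q ++ c₃) ++ u₃) ≡ length u₁ + (length (c₁ ++ q ++ c₃) + length u₃)
  |u|≡ = trans (length-++ u₁) (cong (length u₁ +_) (length-++ (c₁ ++ q ++ c₃)))
  |q|≤n : length q ≤ n
  |q|≤n = ≤-trans |q|≤ (middle-length-≤ (length u₁) (length (c₁ ++ q ++ c₃)) (length u₃) x y n
            (subst (_≤ x + y + n) |u|≡ |u|≤))
  regroup : u₁ ++ (c₁ ++ q ++ c₃) ++ u₃ ≡ (u₁ ++ c₁) ++ q ++ c₃ ++ u₃
  regroup = begin
    u₁ ++ (c₁ ++ q ++ c₃) ++ u₃   ≡⟨ cong (u₁ ++_) (++-assoc c₁ (q ++ c₃) u₃) ⟩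
    u₁ ++ c₁ ++ (q ++ c₃) ++ u₃   ≡⟨ cong (λ z → u₁ ++ c₁ ++ z) (++-assoc q c₃ u₃) ⟩
    u₁ ++ c₁ ++ q ++ c₃ ++ u₃     ≡⟨ ++-assoc u₁ c₁ _ ⟨
    (u₁ ++ c₁) ++ q ++ c₃ ++ u₃   ∎
    where open ≡-Reasoning

≲-middle⁻ : ∀ {x y n} {P a S P̃ ã S̃ : Word σ} → Universal x P → Universal y S →
            Exhaustible x P̃ → Exhaustible y (reverse S̃) →
            (P ++ a ++ S) ≲[ x + y + n ] (P̃ ++ ã ++ S̃) → a ≲[ n ] ã
≲-middle⁻ {x = x} {y} {n} {ã = ã} {S̃ = S̃} UP US (p , |p|≡x , p-exh) (s , |s|≡y , s-exh) h q |q|≤n q⊆a =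
  reverse⁻ (s-exh (reverse q) (reverse ã) s++qᴿ⊆)
  where
  |sᴿ|≡y : length (reverse s) ≡ y
  |sᴿ|≡y = trans (length-reverse s) |s|≡y
  |u|≤ : length (p ++ q ++ reverse s) ≤ x + y + n
  |u|≤ = begin
    length (p ++ q ++ reverse s)               ≡⟨ length-++ p ⟩
    length p + length (q ++ reverse s)         ≡⟨ cong (length p +_) (length-++ q) ⟩
    length p + (length q + length (reverse s)) ≡⟨ cong₂ (λ a b → a + (length q + b)) |p|≡x |sᴿ|≡y ⟩
    x + (length q + y)                         ≤⟨ +-monoʳ-≤ x (+-monoˡ-≤ y |q|≤n) ⟩
    x + (n + y)                                ≡⟨ regroup x y n ⟩
    x + y + n                                  ∎
    where
    open ≤-Reasoning
    regroup : ∀ a b c → a + (c + b) ≡ a + b + c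
    regroup = solve-∀
  q++sᴿ⊆ : q ++ reverse s ⊆ ã ++ S̃
  q++sᴿ⊆ = p-exh _ _ (h _ |u|≤ (++⁺ (universal-≤ UP p (≤-reflexive |p|≡x))
                                   (++⁺ q⊆a (universal-≤ US (reverse s) (≤-reflexive |sᴿ|≡y)))))
  s++qᴿ⊆ : s ++ reverse q ⊆ reverse S̃ ++ reverse ã
  s++qᴿ⊆ = subst₂ _⊆_ (trans (reverse-++ q (reverse s)) (cong (_++ reverse q) (reverse-involutive s)))
                      (reverse-++ ã S̃) (reverse⁺ q++sᴿ⊆)

∼-middle⁺ : ∀ {x y n} {X a b Y : Word σ} → Universal x X → Universal y Y → a ∼[ n ] b →
            (X ++ a ++ Y) ∼[ x + y + n ] (X ++ b ++ Y)
∼-middle⁺ {x = x} {y} UX UY a∼b =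
  ≲∧≳⇒∼ (≲-middle⁺ {x = x} {y} UX UY (∼⇒≲ a∼b)) (≲-middle⁺ {x = x} {y} UX UY (∼⇒≲ (∼-sym a∼b)))

∼-middle⁻ : ∀ {x y n} {P a S P̃ ã S̃ : Word σ} → LeftContext x P → RightContext y S →
            LeftContext x P̃ → RightContext y S̃ →
            (P ++ a ++ S) ∼[ x + y + n ] (P̃ ++ ã ++ S̃) → a ∼[ n ] ã
∼-middle⁻ {x = x} {y} (UP , EP) (US , ES) (UP̃ , EP̃) (US̃ , ES̃) h =
  ≲∧≳⇒∼ (≲-middle⁻ {x = x} {y} UP US EP̃ ES̃ (∼⇒≲ h)) (≲-middle⁻ {x = x} {y} UP̃ US̃ EP ES (∼⇒≲ (∼-sym h)))

tabulate-inject₁ : ∀ n (f : Fin (suc n) → A) → tabulate f ≡ tabulate (f ∘ inject₁) ++ [ f (fromℕ n) ]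
tabulate-inject₁ zero    f = refl
tabulate-inject₁ (suc n) f = cong (f zero ∷_) (tabulate-inject₁ n (f ∘ suc))

++-assoc-shift : ∀ (X Y Z W : List A) → (X ++ Y) ++ Z ++ W ≡ X ++ (Y ++ Z) ++ W
++-assoc-shift X Y Z W = trans (++-assoc X Y (Z ++ W)) (cong (X ++_) (sym (++-assoc Y Z W)))

-- With w = abWord m α β, ar α β i and ra α β i are the arches arᵢ₊₁(w) and raᵢ₊₁(w).
ar : ∀ {m} → (Fin (suc m) → Word σ) → (Fin m → Word σ) → Fin m → Word σ
ar α β i = α (inject₁ i) ++ β i

ra : ∀ {m} → (Fin (suc m) → Word σ) → (Fin m → Word σ) → Fin m → Word σ
ra α β i = β i ++ α (suc i)

Arches : ∀ m → (Fin (suc m) → Word σ) → (Fin m → Word σ) → Set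
Arches m α β = ∀ i → IsArch (ar α β i) × IsArch (reverse (ra α β i))

concat-ar-++≡abWord : ∀ m (α : Fin (suc m) → Word σ) β →
                      concat (tabulate (ar α β)) ++ α (fromℕ m) ≡ abWord m α β
concat-ar≡abWord-++ : ∀ m (α : Fin (suc (suc m)) → Word σ) β →
                      concat (tabulate (ar α β)) ≡ abWord m (α ∘ inject₁) (β ∘ inject₁) ++ β (fromℕ m)

concat-ar-++≡abWord zero    α β = refl
concat-ar-++≡abWord (suc m) α β = trans (cong (_++ α (fromℕ (suc m))) (concat-ar≡abWord-++ m α β))
                                          (++-assoc (abWord m (α ∘ inject₁) (β ∘ inject₁)) (β (fromℕ m)) _)

concat-ar≡abWord-++ m α β = begin
  concat (tabulate (ar α β))                        ≡⟨ cong concat (tabulate-inject₁ m (ar α β)) ⟩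
  concat (tabulate (ar α′ β′) ++ [ ar α β (fromℕ m) ]) ≡⟨ concat-++ (tabulate (ar α′ β′)) _ ⟨
  C ++ (α′ (fromℕ m) ++ β (fromℕ m)) ++ []          ≡⟨ cong (C ++_) (++-identityʳ _) ⟩
  C ++ α′ (fromℕ m) ++ β (fromℕ m)                  ≡⟨ ++-assoc C _ _ ⟨
  (C ++ α′ (fromℕ m)) ++ β (fromℕ m)
    ≡⟨ cong (_++ β (fromℕ m)) (concat-ar-++≡abWord m α′ β′) ⟩
  abWord m α′ β′ ++ β (fromℕ m)                     ∎
  where
  open ≡-Reasoning
  α′ = α ∘ inject₁
  β′ = β ∘ inject₁
  C = concat (tabulate (ar α′ β′))

abWord-suc-++ : ∀ m (α : Fin (suc (suc m)) → Word σ) β Z →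
                abWord (suc m) α β ++ Z
                  ≡ (abWord m (α ∘ inject₁) (β ∘ inject₁) ++ β (fromℕ m)) ++ α (fromℕ (suc m)) ++ Z
abWord-suc-++ m α β Z = trans (++-assoc P _ Z) (sym (++-assoc-shift P (β (fromℕ m)) (α (fromℕ (suc m))) Z))
  where P = abWord m (α ∘ inject₁) (β ∘ inject₁)

AllArches-tabulate⁻ : ∀ n (f : Fin n → Word σ) → AllArches (tabulate f) → ∀ i → IsArch (f i)
AllArches-tabulate⁻ (suc n) f (a ∷ as) zero    = a
AllArches-tabulate⁻ (suc n) f (a ∷ as) (suc i) = AllArches-tabulate⁻ n (f ∘ suc) as i

abFact⇒≡abWord : ∀ {w : Word σ} m α β → IsABFact w m α β → w ≡ abWord m α β
abFact⇒≡abWord m α β ((w≡ , _) , _) = trans w≡ (concat-ar-++≡abWord m α β)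

abFact⇒arches : ∀ {w : Word σ} m α β → IsABFact w m α β → Arches m α β
abFact⇒arches m α β ((_ , ars , _) , (_ , ras , _)) i =
  AllArches-tabulate⁻ m (ar α β) ars i ,
  subst (IsArch ∘ reverse ∘ ra α β) (opposite-involutive i) (AllArches-tabulate⁻ m _ ras (opposite i))

leftContext-concat : ∀ n (f : Fin n → Word σ) → (∀ i → IsArch (f i)) → LeftContext n (concat (tabulate f))
leftContext-concat zero    f _     = leftContext-[]
leftContext-concat (suc n) f arch =
  leftContext-++ (arch⇒leftContext (arch zero)) (leftContext-concat n (f ∘ suc) (arch ∘ suc))

leftContext-abWord-++ : ∀ m (α : Fin (suc (suc m)) → Word σ) β → (∀ i → IsArch (ar α β i)) →
                        LeftContext (suc m) (abWord m (α ∘ inject₁) (β ∘ inject₁) ++ β (fromℕ m))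
leftContext-abWord-++ m α β arch =
  subst (LeftContext (suc m)) (concat-ar≡abWord-++ m α β) (leftContext-concat (suc m) (ar α β) arch)

Complete-++-∼ʳ : ∀ {n} {c a b : Word σ} → 1 ≤ n → a ∼[ n ] b → Complete (c ++ b) → Complete (c ++ a)
Complete-++-∼ʳ {c = c} 1≤n a∼b c++b-complete x with ∈-++⁻ c (c++b-complete x)
... | inj₁ x∈c = ∈-++⁺ˡ x∈c
... | inj₂ x∈b = ∈-++⁺ʳ c (∈-resp-∼ 1≤n a∼b x∈b)

∼-exchange-αs : ∀ m {n z} (α α̃ : Fin (suc m) → Word σ) (β̃ : Fin m → Word σ) {Z : Word σ} →
                (∀ i → IsArch (ar α̃ β̃ i)) → (∀ i → Complete (ra α β̃ i)) → (∀ i → α i ∼[ n ] α̃ i) →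
                Universal z Z → (abWord m α̃ β̃ ++ Z) ∼[ m + z + n ] (abWord m α β̃ ++ Z)
∼-exchange-αs zero    α α̃ β̃ _ _ α∼α̃ UZ = ∼-middle⁺ {x = 0} (universal-0 []) UZ (∼-sym (α∼α̃ zero))
∼-exchange-αs (suc m) {n} {z} α α̃ β̃ {Z} ar̃ ra-complete α∼α̃ UZ = begin
  abWord (suc m) α̃ β̃ ++ Z            ≡⟨ abWord-suc-++ m α̃ β̃ Z ⟩
  (P̃ ++ β̃ (fromℕ m)) ++ α̃ last ++ Z  ≈⟨ ∼-middle⁺ UP̃ UZ (∼-sym (α∼α̃ last)) ⟩
  (P̃ ++ β̃ (fromℕ m)) ++ α last ++ Z  ≡⟨ ++-assoc-shift P̃ (β̃ (fromℕ m)) (α last) Z ⟩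
  P̃ ++ Z′                            ≈⟨ ∼-resp-≡ (cong (_+ n) (+-suc m z)) exchange-rest ⟩
  P ++ Z′                            ≡⟨ ++-assoc P (ra α β̃ (fromℕ m)) Z ⟨
  abWord (suc m) α β̃ ++ Z            ∎
  where
  open ∼-Reasoning (suc m + z + n)
  last = fromℕ (suc m)
  P = abWord m (α ∘ inject₁) (β̃ ∘ inject₁)
  P̃ = abWord m (α̃ ∘ inject₁) (β̃ ∘ inject₁)
  Z′ = ra α β̃ (fromℕ m) ++ Z
  UP̃ : Universal (suc m) (P̃ ++ β̃ (fromℕ m))
  UP̃ = proj₁ (leftContext-abWord-++ m α̃ β̃ ar̃)
  UZ′ : Universal (suc z) Z′
  UZ′ = universal-++ (complete⇒universal-1 (ra-complete (fromℕ m))) UZ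
  exchange-rest : (P̃ ++ Z′) ∼[ m + suc z + n ] (P ++ Z′)
  exchange-rest = ∼-exchange-αs m (α ∘ inject₁) (α̃ ∘ inject₁) (β̃ ∘ inject₁)
                    (ar̃ ∘ inject₁) (ra-complete ∘ inject₁) (α∼α̃ ∘ inject₁) UZ′

∼-extract-αs : ∀ m {n j} (α α̃ : Fin (suc m) → Word σ) (β β̃ : Fin m → Word σ) {Z Z̃ : Word σ} →
               Arches m α β → Arches m α̃ β̃ → RightContext j Z → RightContext j Z̃ →
               (abWord m α β ++ Z) ∼[ m + j + n ] (abWord m α̃ β̃ ++ Z̃) → ∀ i → α i ∼[ n ] α̃ i
∼-extract-αs zero    α α̃ β β̃ _ _ RZ RZ̃ h zero = ∼-middle⁻ {x = 0} leftContext-[] RZ leftContext-[] RZ̃ h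
∼-extract-αs (suc m) {n} {j} α α̃ β β̃ {Z} {Z̃} arches arches̃ RZ RZ̃ h i with view i
... | ‵fromℕ = ∼-middle⁻ (leftContext-abWord-++ m α β (proj₁ ∘ arches)) RZ
                         (leftContext-abWord-++ m α̃ β̃ (proj₁ ∘ arches̃)) RZ̃ (begin
  _ ≡⟨ abWord-suc-++ m α β Z ⟨
  abWord (suc m) α β ++ Z   ≈⟨ h ⟩
  abWord (suc m) α̃ β̃ ++ Z̃   ≡⟨ abWord-suc-++ m α̃ β̃ Z̃ ⟩
  _ ∎)
  where open ∼-Reasoning (suc m + j + n)
... | ‵inject₁ i′ = ∼-extract-αs m (α ∘ inject₁) (α̃ ∘ inject₁) (β ∘ inject₁) (β̃ ∘ inject₁)
                      (arches ∘ inject₁) (arches̃ ∘ inject₁) (RZ′ α β arches RZ) (RZ′ α̃ β̃ arches̃ RZ̃)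
                      (∼-resp-≡ (cong (_+ n) (sym (+-suc m j))) (begin
    P ++ ra α β (fromℕ m) ++ Z     ≡⟨ ++-assoc P (ra α β (fromℕ m)) Z ⟨
    abWord (suc m) α β ++ Z        ≈⟨ h ⟩
    abWord (suc m) α̃ β̃ ++ Z̃        ≡⟨ ++-assoc P̃ (ra α̃ β̃ (fromℕ m)) Z̃ ⟩
    P̃ ++ ra α̃ β̃ (fromℕ m) ++ Z̃     ∎)) i′
  where
  open ∼-Reasoning (suc m + j + n)
  P = abWord m (α ∘ inject₁) (β ∘ inject₁)
  P̃ = abWord m (α̃ ∘ inject₁) (β̃ ∘ inject₁)
  RZ′ : ∀ α β {Z : Word σ} → Arches (suc m) α β → RightContext j Z →
        RightContext (suc j) (ra α β (fromℕ m) ++ Z)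
  RZ′ α β arches RZ = rightContext-++ (reverseArch⇒rightContext (proj₂ (arches (fromℕ m)))) RZ

corollary1 : ∀ {σ : ℕ} (k m : ℕ) (w w̃ : Word σ)
               (α α̃ : Fin (suc m) → Word σ) (β β̃ : Fin m → Word σ)
             → ι≡ w m → ι≡ w̃ m → m < k
             → IsABFact w m α β → IsABFact w̃ m α̃ β̃
             → (w ∼[ k ] w̃)
               ⇔ ((∀ (i : Fin (suc m)) → α i ∼[ k ∸ m ] α̃ i) × (w ∼[ k ] abWord m α β̃))
corollary1 k m w w̃ α α̃ β β̃ _ _ m<k abw abw̃ = mk⇔
  (λ w∼w̃ → factors∼ w∼w̃ , ∼-trans w∼w̃ (w̃∼w′ (factors∼ w∼w̃)))
  (λ (α∼α̃ , w∼w′) → ∼-trans w∼w′ (∼-sym (w̃∼w′ α∼α̃)))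
  where
  n = k ∸ m
  m+0+n≡k : m + 0 + n ≡ k
  m+0+n≡k = trans (cong (_+ n) (+-identityʳ m)) (m+[n∸m]≡n (<⇒≤ m<k))
  open ∼-Reasoning (m + 0 + n)
  arches = abFact⇒arches m α β abw
  arches̃ = abFact⇒arches m α̃ β̃ abw̃
  w≡ : w ≡ abWord m α β ++ []
  w≡ = trans (abFact⇒≡abWord m α β abw) (sym (++-identityʳ _))
  w̃≡ : w̃ ≡ abWord m α̃ β̃ ++ []
  w̃≡ = trans (abFact⇒≡abWord m α̃ β̃ abw̃) (sym (++-identityʳ _))
  factors∼ : w ∼[ k ] w̃ → ∀ i → α i ∼[ n ] α̃ i
  factors∼ w∼w̃ = ∼-extract-αs m α α̃ β β̃ arches arches̃ rightContext-[] rightContext-[] (begin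
    abWord m α β ++ []   ≡⟨ w≡ ⟨
    w                    ≈⟨ ∼-resp-≡ (sym m+0+n≡k) w∼w̃ ⟩
    w̃                    ≡⟨ w̃≡ ⟩
    abWord m α̃ β̃ ++ []   ∎)
  w̃∼w′ : (∀ i → α i ∼[ n ] α̃ i) → w̃ ∼[ k ] abWord m α β̃
  w̃∼w′ α∼α̃ = ∼-resp-≡ m+0+n≡k (begin
    w̃                    ≡⟨ w̃≡ ⟩
    abWord m α̃ β̃ ++ []   ≈⟨ ∼-exchange-αs m α α̃ β̃ (proj₁ ∘ arches̃) ra-complete α∼α̃ (universal-0 []) ⟩
    abWord m α β̃ ++ []   ≡⟨ ++-identityʳ _ ⟩
    abWord m α β̃         ∎)
    where
    ra-complete : ∀ i → Complete (ra α β̃ i)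
    ra-complete i = Complete-++-∼ʳ {c = β̃ i} (m<n⇒0<n∸m m<k) (α∼α̃ (suc i))
                      (reverseArch⇒complete (proj₂ (arches̃ i)))
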